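{- Let $G$ be a connected graph on at least two vertices. Then $\mu^{ - }(G)=2$ if and only if $G$ has a cut-edge.
   Context: A cut-edge is an edge whose removal disconnects the graph. For $X\subseteq V(G)$, two vertices $a,b$ are $X$-visible if there is a shortest $a,b$-path $P$ in $G$ with $V(P)\cap X\subseteq\{a,b\}$. A set $X$ is a mutual-visibility set if every two vertices of $X$ are $X$-visible; it is maximal if no proper superset is one. $\mu^{ - }(G)$ is the minimum cardinality of a maximal mutual-visibility set of $G$. -}

module Defs where

open import Data.Nat using (ℕ; zero; suc; _≤_)
open import Data.Fin using (Fin)
open import Data.Fin.Subset using (Subset; _∈_; _⊂_; ∣_∣)
open import Data.Bool using (Bool; true; false)
open import Data.Product using (Σ; ∃; _×_; _,_)
open import Data.Sum using (_⊎_)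
open import Relation.Nullary using (¬_)
open import Relation.Binary.PropositionalEquality using (_≡_)

record Graph (n : ℕ) : Set where
  field
    adj    : Fin n → Fin n → Bool
    sym    : ∀ u v → adj u v ≡ adj v u
    irrefl : ∀ u → adj u u ≡ false
open Graph public

module _ {n : ℕ} where

  Adj : Graph n → Fin n → Fin n → Set
  Adj G u v = adj G u v ≡ true

  data Walk (R : Fin n → Fin n → Set) : Fin n → Fin n → ℕ → Set where
    []  : ∀ {a} → Walk R a a zero
    _∷_ : ∀ {a b c k} → R a b → Walk R b c k → Walk R a c (suc k)

  data OnWalk {R : Fin n → Fin n → Set} (x : Fin n) :
         ∀ {a b k} → Walk R a b k → Set where
    here  : ∀ {b c k} {e : R x b} {w : Walk R b c k} → OnWalk x (e ∷ w)
    there : ∀ {a b c k} {e : R a b} {w : Walk R b c k} → OnWalk x w → OnWalk x (e ∷ w)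
    end   : OnWalk x ([] {a = x})

  Connected : (Fin n → Fin n → Set) → Set
  Connected R = ∀ a b → ∃ λ k → Walk R a b k

  DeleteEdge : Graph n → Fin n → Fin n → Fin n → Fin n → Set
  DeleteEdge G u v a b =
    Adj G a b × ¬ ((a ≡ u × b ≡ v) ⊎ (a ≡ v × b ≡ u))

  IsCutEdge : Graph n → Fin n → Fin n → Set
  IsCutEdge G u v = Adj G u v × ¬ Connected (DeleteEdge G u v)

  HasCutEdge : Graph n → Set
  HasCutEdge G = Σ (Fin n) λ u → Σ (Fin n) λ v → IsCutEdge G u v

  IsShortest : (G : Graph n) {a b : Fin n} {k : ℕ} → Walk (Adj G) a b k → Set
  IsShortest G {a} {b} {k} w = ∀ k′ → Walk (Adj G) a b k′ → k ≤ k′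

  Visible : Graph n → Subset n → Fin n → Fin n → Set
  Visible G X a b =
    Σ ℕ λ k → Σ (Walk (Adj G) a b k) λ w →
      IsShortest G w × (∀ x → OnWalk x w → x ∈ X → (x ≡ a ⊎ x ≡ b))

  IsMutualVisibility : Graph n → Subset n → Set
  IsMutualVisibility G X = ∀ a b → a ∈ X → b ∈ X → Visible G X a b

  IsMaximalMV : Graph n → Subset n → Set
  IsMaximalMV G X =
    IsMutualVisibility G X × (∀ Y → X ⊂ Y → ¬ IsMutualVisibility G Y)

  μ⁻≡ : Graph n → ℕ → Set
  μ⁻≡ G m =
    (Σ (Subset n) λ X → IsMaximalMV G X × ∣ X ∣ ≡ m)
    × (∀ X → IsMaximalMV G X → m ≤ ∣ X ∣)

-- Visibility within a set is witnessed by a geodesic avoiding the other members, so if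
-- {a, b} is a maximal mutual-visibility set there is no third vertex z admitting, for each
-- of the pairs ab, az, bz, a geodesic avoiding the remaining vertex. Let v follow a on an
-- a,b-geodesic. If av were not a cut-edge, a walk from a to v in G - av would leave the set
-- of vertices y with a on some y,b-geodesic along an edge yz; comparing the distances of y
-- and z to a and b shows that z, y or v is such a third vertex. Conversely, if uv is a
-- cut-edge, a vertex y seeing u and v past each other would join u to v in G - uv; and no
-- maximal set has fewer than two vertices, since the ends of an edge see each other.
module Submission where

open import Defs hiding (sym)
open import Data.Nat using (ℕ; zero; suc; _+_; _≤_; _<_; z≤n; s≤s; s≤s⁻¹)
open import Data.Nat.Properties
open import Data.Fin using (Fin; zero; suc; punchIn) renaming (_≟_ to _≟ᶠ_)
open import Data.Fin.Properties using (any?; punchInᵢ≢i)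
open import Data.Fin.Subset using (Subset; _∈_; _∉_; _⊆_; _⊂_; ∣_∣; ⁅_⁆; _∪_)
open import Data.Fin.Subset.Properties
  using (_∈?_; x∈⁅x⁆; x∈⁅y⁆⇒x≡y; x∈p∪q⁻; p⊆p∪q; q⊆p∪q; ∣⁅x⁆∣≡1; ∪-identityˡ; ∪-identityʳ;
         p⊆q⇒∣p∣≤∣q∣; p⊂q⇒∣p∣<∣q∣)
open import Data.Bool using (true) renaming (_≟_ to _≟ᵇ_)
open import Data.Product using (Σ; ∃; ∃₂; _×_; _,_; proj₁; proj₂) renaming (map to ×-map; swap to ×-swap)
open import Data.Sum using (_⊎_; inj₁; inj₂; map; map₁; map₂; swap; assocʳ; [_,_]′)
open import Data.Empty using (⊥; ⊥-elim)
open import Function using (_∘_)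
open import Function.Bundles using (_⇔_; mk⇔)
open import Relation.Nullary using (¬_; Dec; yes; no; contradiction)
open import Relation.Nullary.Decidable using (_×-dec_; _⊎-dec_; ¬?; decidable-stable)
open import Relation.Binary.Definitions using (Symmetric; Decidable)
open import Relation.Binary.PropositionalEquality
  using (_≡_; _≢_; refl; sym; trans; cong; subst; subst₂; ≢-sym; module ≡-Reasoning)

module _ {n : ℕ} {R : Fin n → Fin n → Set} where

  private variable
    a b c x : Fin n
    i j k : ℕ

  _∷ʳ_ : Walk R a b k → R b c → Walk R a c (suc k)
  []      ∷ʳ e = e ∷ []
  (d ∷ w) ∷ʳ e = d ∷ (w ∷ʳ e)

  reverse : Symmetric R → Walk R a b k → Walk R b a k
  reverse s []      = []
  reverse s (e ∷ w) = reverse s w ∷ʳ s e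

  _++_ : Walk R a b i → Walk R b c j → Walk R a c (i + j)
  []      ++ w = w
  (e ∷ v) ++ w = e ∷ (v ++ w)

  start-onWalk : (w : Walk R a b k) → OnWalk a w
  start-onWalk []      = end
  start-onWalk (e ∷ w) = here

  end-onWalk : (w : Walk R a b k) → OnWalk b w
  end-onWalk []      = end
  end-onWalk (e ∷ w) = there (end-onWalk w)

  onWalk-∷ʳ : (w : Walk R a b k) (e : R b c) → OnWalk x (w ∷ʳ e) → OnWalk x w ⊎ x ≡ c
  onWalk-∷ʳ []      e here        = inj₁ end
  onWalk-∷ʳ []      e (there end) = inj₂ refl
  onWalk-∷ʳ (d ∷ w) e here        = inj₁ here
  onWalk-∷ʳ (d ∷ w) e (there o)   = map₁ there (onWalk-∷ʳ w e o)

  onWalk-reverse : (s : Symmetric R) (w : Walk R a b k) → OnWalk x (reverse s w) → OnWalk x w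
  onWalk-reverse s []      end = end
  onWalk-reverse s (e ∷ w) o with onWalk-∷ʳ (reverse s w) (s e) o
  ... | inj₁ o′   = there (onWalk-reverse s w o′)
  ... | inj₂ refl = here

  walk-length-0 : Walk R a b 0 → a ≡ b
  walk-length-0 [] = refl

  split-at : (w : Walk R a b k) → OnWalk x w →
             ∃₂ λ i j → Walk R a x i × Walk R x b j × i + j ≡ k
  split-at (e ∷ w) here      = 0 , _ , [] , e ∷ w , refl
  split-at (e ∷ w) (there o) with split-at w o
  ... | i , j , w₁ , w₂ , eq = suc i , j , e ∷ w₁ , w₂ , cong suc eq
  split-at []      end       = 0 , 0 , [] , [] , refl

  first-step : Walk R a b k → a ≢ b → ∃ λ c → R a c
  first-step []      a≢b = contradiction refl a≢b
  first-step (e ∷ w) _   = _ , e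

  crossing-step : (P : Fin n → Set) → (∀ x → Dec (P x)) → Walk R a c k → P a → ¬ P c →
                  ∃₂ λ y z → R y z × P y × ¬ P z
  crossing-step P P? []                  Pa ¬Pc = contradiction Pa ¬Pc
  crossing-step P P? (_∷_ {b = b} e w) Pa ¬Pc with P? b
  ... | yes Pb = crossing-step P P? w Pb ¬Pc
  ... | no ¬Pb = _ , b , e , Pa , ¬Pb

  walk? : Decidable R → ∀ k a b → Dec (Walk R a b k)
  walk? R? zero    a b with a ≟ᶠ b
  ... | yes refl = yes []
  ... | no a≢b   = no (a≢b ∘ walk-length-0)
  walk? R? (suc k) a b with any? (λ c → R? a c ×-dec walk? R? k c b)
  ... | yes (c , e , w) = yes (e ∷ w)
  ... | no ∄c           = no λ { (e ∷ w) → ∄c (_ , e , w) }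

least : (P : ℕ → Set) → (∀ k → Dec (P k)) → ∀ k → P k → ∃ λ m → P m × (∀ j → P j → m ≤ j)
least P P? zero    Pk = 0 , Pk , λ _ _ → z≤n
least P P? (suc k) Pk with P? 0
... | yes P0 = 0 , P0 , λ _ _ → z≤n
... | no ¬P0 with least (P ∘ suc) (P? ∘ suc) k Pk
...   | m , Pm , m-least = suc m , Pm , λ { zero P0 → contradiction P0 ¬P0 ; (suc j) Pj → s≤s (m-least j Pj) }

∣⁅x⁆∪⁅y⁆∣≡2 : ∀ {n} (x y : Fin n) → x ≢ y → ∣ ⁅ x ⁆ ∪ ⁅ y ⁆ ∣ ≡ 2
∣⁅x⁆∪⁅y⁆∣≡2 zero    zero    x≢y = contradiction refl x≢y
∣⁅x⁆∪⁅y⁆∣≡2 zero    (suc y) _   = cong suc (trans (cong ∣_∣ (∪-identityˡ ⁅ y ⁆)) (∣⁅x⁆∣≡1 y))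
∣⁅x⁆∪⁅y⁆∣≡2 (suc x) zero    _   = cong suc (trans (cong ∣_∣ (∪-identityʳ ⁅ x ⁆)) (∣⁅x⁆∣≡1 x))
∣⁅x⁆∪⁅y⁆∣≡2 (suc x) (suc y) x≢y = ∣⁅x⁆∪⁅y⁆∣≡2 x y (x≢y ∘ cong suc)

module _ {n : ℕ} where

  private variable
    p : Subset n
    x y z : Fin n

  ∈⁅x⁆∪⁅y⁆⇒ : z ∈ ⁅ x ⁆ ∪ ⁅ y ⁆ → z ≡ x ⊎ z ≡ y
  ∈⁅x⁆∪⁅y⁆⇒ {x = x} {y = y} = map (x∈⁅y⁆⇒x≡y x) (x∈⁅y⁆⇒x≡y y) ∘ x∈p∪q⁻ ⁅ x ⁆ ⁅ y ⁆

  x∈⁅x⁆∪⁅y⁆ : ∀ (x y : Fin n) → x ∈ ⁅ x ⁆ ∪ ⁅ y ⁆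
  x∈⁅x⁆∪⁅y⁆ x y = p⊆p∪q ⁅ y ⁆ (x∈⁅x⁆ x)

  y∈⁅x⁆∪⁅y⁆ : ∀ (x y : Fin n) → y ∈ ⁅ x ⁆ ∪ ⁅ y ⁆
  y∈⁅x⁆∪⁅y⁆ x y = q⊆p∪q ⁅ x ⁆ ⁅ y ⁆ (x∈⁅x⁆ y)

  ⁅x⁆∪⁅y⁆⊆p : x ∈ p → y ∈ p → ⁅ x ⁆ ∪ ⁅ y ⁆ ⊆ p
  ⁅x⁆∪⁅y⁆⊆p x∈p y∈p z∈xy with ∈⁅x⁆∪⁅y⁆⇒ z∈xy
  ... | inj₁ refl = x∈p
  ... | inj₂ refl = y∈p

  2≤∣p∣ : x ∈ p → y ∈ p → x ≢ y → 2 ≤ ∣ p ∣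
  2≤∣p∣ {x = x} {y = y} x∈p y∈p x≢y =
    subst (_≤ _) (∣⁅x⁆∪⁅y⁆∣≡2 x y x≢y) (p⊆q⇒∣p∣≤∣q∣ (⁅x⁆∪⁅y⁆⊆p x∈p y∈p))

  ⊆⁅x⁆⊎∃≢x : ∀ (p : Subset n) x → p ⊆ ⁅ x ⁆ ⊎ ∃ λ y → y ∈ p × y ≢ x
  ⊆⁅x⁆⊎∃≢x p x with any? (λ y → (y ∈? p) ×-dec ¬? (y ≟ᶠ x))
  ... | yes y∈p∖x = inj₂ y∈p∖x
  ... | no ∄y     = inj₁ λ {y} y∈p →
    subst (_∈ ⁅ x ⁆) (sym (decidable-stable (y ≟ᶠ x) (λ y≢x → ∄y (y , y∈p , y≢x)))) (x∈⁅x⁆ x)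

⊆⁅x⁆⊎∃₂≢ : ∀ {m} (p : Subset (suc m)) →
           (∃ λ x → p ⊆ ⁅ x ⁆) ⊎ (∃₂ λ x y → x ∈ p × y ∈ p × x ≢ y)
⊆⁅x⁆⊎∃₂≢ p with ⊆⁅x⁆⊎∃≢x p zero
... | inj₁ p⊆⁅0⁆ = inj₁ (zero , p⊆⁅0⁆)
... | inj₂ (x , x∈p , _) with ⊆⁅x⁆⊎∃≢x p x
...   | inj₁ p⊆⁅x⁆          = inj₁ (x , p⊆⁅x⁆)
...   | inj₂ (y , y∈p , y≢x) = inj₂ (x , y , x∈p , y∈p , ≢-sym y≢x)

∣p∣≡2⇒⊆⁅x⁆∪⁅y⁆ : ∀ {m} (p : Subset (suc m)) → ∣ p ∣ ≡ 2 →
                 ∃₂ λ x y → x ≢ y × p ⊆ ⁅ x ⁆ ∪ ⁅ y ⁆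
∣p∣≡2⇒⊆⁅x⁆∪⁅y⁆ p ∣p∣≡2 with ⊆⁅x⁆⊎∃₂≢ p
... | inj₁ (x , p⊆⁅x⁆) = contradiction (subst₂ _≤_ ∣p∣≡2 (∣⁅x⁆∣≡1 x) (p⊆q⇒∣p∣≤∣q∣ p⊆⁅x⁆)) λ { (s≤s ()) }
... | inj₂ (x , y , x∈p , y∈p , x≢y) = x , y , x≢y , λ {z} z∈p →
  decidable-stable (z ∈? ⁅ x ⁆ ∪ ⁅ y ⁆) λ z∉xy →
    <-irrefl refl (subst₂ _<_ (∣⁅x⁆∪⁅y⁆∣≡2 x y x≢y) ∣p∣≡2
                    (p⊂q⇒∣p∣<∣q∣ (⁅x⁆∪⁅y⁆⊆p x∈p y∈p , z , z∈p , z∉xy)))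

m+n≡m⇒n≡0 : ∀ m {n} → m + n ≡ m → n ≡ 0
m+n≡m⇒n≡0 m {n} eq = +-cancelˡ-≡ m n 0 (trans eq (sym (+-identityʳ m)))

m+n≡n⇒m≡0 : ∀ m {n} → m + n ≡ n → m ≡ 0
m+n≡n⇒m≡0 m {n} eq = m+n≡m⇒n≡0 n (trans (+-comm n m) eq)

m+[n+o]≤1+o⇒m≡0×n≡1 : ∀ m n o → m + (n + o) ≤ suc o → n ≢ 0 → m ≡ 0 × n ≡ 1
m+[n+o]≤1+o⇒m≡0×n≡1 m zero    o _  n≢0 = contradiction refl n≢0
m+[n+o]≤1+o⇒m≡0×n≡1 m (suc n) o le _
  with subst (_≤ 1) (+-suc m n) (+-cancelʳ-≤ o (m + suc n) 1 (subst (_≤ suc o) (sym (+-assoc m (suc n) o)) le))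
... | s≤s m+n≤0 = m+n≡0⇒m≡0 m (n≤0⇒n≡0 m+n≤0) , cong suc (m+n≡0⇒n≡0 m (n≤0⇒n≡0 m+n≤0))

m+o≤1+n×n+o≤1+m⇒o≤1 : ∀ m n o → m + o ≤ suc n → n + o ≤ suc m → o ≤ 1
m+o≤1+n×n+o≤1+m⇒o≤1 m n zero          _  _  = z≤n
m+o≤1+n×n+o≤1+m⇒o≤1 m n (suc zero)    _  _  = s≤s z≤n
m+o≤1+n×n+o≤1+m⇒o≤1 m n (suc (suc o)) le₁ le₂ = ⊥-elim (<-asym (m<n le₁) (m<n le₂))
  where
  m<n : ∀ {m n} → m + suc (suc o) ≤ suc n → m < n
  m<n {m} {n} le = s≤s⁻¹ (≤-trans (s≤s (s≤s (m≤m+n m o)))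
                                  (subst (_≤ suc n) (trans (+-suc m (suc o)) (cong suc (+-suc m o))) le))

module Visibility {n : ℕ} (G : Graph n) where

  private variable
    a b p q r : Fin n
    Y : Subset n
    k : ℕ

  Adj-sym : Symmetric (Adj G)
  Adj-sym {a} {b} e = trans (Graph.sym G b a) e

  Adj⇒≢ : Adj G a b → a ≢ b
  Adj⇒≢ {a} e refl with trans (sym e) (Graph.irrefl G a)
  ... | ()

  adj? : Decidable (Adj G)
  adj? a b = adj G a b ≟ᵇ true

  reverse-shortest : (w : Walk (Adj G) a b k) → IsShortest G w → IsShortest G (reverse Adj-sym w)
  reverse-shortest w sh j w′ = sh j (reverse Adj-sym w′)

  visible-refl : Visible G Y a a
  visible-refl = 0 , [] , (λ _ _ → z≤n) , λ { _ end _ → inj₁ refl }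

  visible-sym : Visible G Y a b → Visible G Y b a
  visible-sym (k , w , sh , on-ends) =
    k , reverse Adj-sym w , reverse-shortest w sh ,
    λ x o x∈Y → swap (on-ends x (onWalk-reverse Adj-sym w o) x∈Y)

  edge-shortest : (e : Adj G a b) → IsShortest G (e ∷ [])
  edge-shortest e zero    w = contradiction (walk-length-0 w) (Adj⇒≢ e)
  edge-shortest e (suc _) _ = s≤s z≤n

  edge-visible : Adj G a b → Visible G Y a b
  edge-visible e = 1 , e ∷ [] , edge-shortest e , λ { _ here _ → inj₁ refl ; _ (there end) _ → inj₂ refl }

  edge-mutual-visibility : Adj G a b → IsMutualVisibility G (⁅ a ⁆ ∪ ⁅ b ⁆)
  edge-mutual-visibility e p q p∈ q∈ with ∈⁅x⁆∪⁅y⁆⇒ p∈ | ∈⁅x⁆∪⁅y⁆⇒ q∈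
  ... | inj₁ refl | inj₁ refl = visible-refl
  ... | inj₁ refl | inj₂ refl = edge-visible e
  ... | inj₂ refl | inj₁ refl = visible-sym (edge-visible e)
  ... | inj₂ refl | inj₂ refl = visible-refl

  GeodesicAvoiding : Fin n → Fin n → Fin n → Set
  GeodesicAvoiding p q r = Σ ℕ λ k → Σ (Walk (Adj G) p q k) λ w → IsShortest G w × ¬ OnWalk r w

  avoiding-sym : GeodesicAvoiding p q r → GeodesicAvoiding q p r
  avoiding-sym (k , w , sh , ¬r) = k , reverse Adj-sym w , reverse-shortest w sh , ¬r ∘ onWalk-reverse Adj-sym w

  avoiding⇒≢ : GeodesicAvoiding p q r → r ≢ p × r ≢ q
  avoiding⇒≢ (_ , w , _ , ¬r) = (λ { refl → ¬r (start-onWalk w) }) , (λ { refl → ¬r (end-onWalk w) })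

  avoiding-edge : (e : Adj G p q) → r ≢ p → r ≢ q → GeodesicAvoiding p q r
  avoiding-edge e r≢p r≢q = 1 , e ∷ [] , edge-shortest e , λ { here → r≢p refl ; (there end) → r≢q refl }

  visible⇒avoiding : Visible G Y p q → r ∈ Y → r ≢ p → r ≢ q → GeodesicAvoiding p q r
  visible⇒avoiding (k , w , sh , on-ends) r∈Y r≢p r≢q =
    k , w , sh , λ o → [ r≢p , r≢q ]′ (on-ends _ o r∈Y)

  avoiding⇒visible : (∀ x → x ∈ Y → x ≡ p ⊎ x ≡ q ⊎ x ≡ r) → GeodesicAvoiding p q r → Visible G Y p q
  avoiding⇒visible Y⊆pqr (k , w , sh , ¬r) = k , w , sh , on-ends
    where
    on-ends : ∀ x → OnWalk x w → x ∈ _ → _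
    on-ends x o x∈Y with Y⊆pqr x x∈Y
    ... | inj₁ x≡p        = inj₁ x≡p
    ... | inj₂ (inj₁ x≡q) = inj₂ x≡q
    ... | inj₂ (inj₂ refl) = contradiction o ¬r

  triple-mutual-visibility : (∀ x → x ∈ Y → x ≡ a ⊎ x ≡ b ⊎ x ≡ r) →
    GeodesicAvoiding a b r → GeodesicAvoiding a r b → GeodesicAvoiding b r a →
    IsMutualVisibility G Y
  triple-mutual-visibility {Y = Y} {a = a} {b = b} {r = r} Y⊆abr ab ar br = mutual-visibility
    where
    vis-ab : Visible G Y a b
    vis-ab = avoiding⇒visible Y⊆abr ab

    vis-ar : Visible G Y a r
    vis-ar = avoiding⇒visible (λ x → map₂ swap ∘ Y⊆abr x) ar

    vis-br : Visible G Y b r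
    vis-br = avoiding⇒visible (λ x → assocʳ ∘ swap ∘ Y⊆abr x) br

    mutual-visibility : IsMutualVisibility G Y
    mutual-visibility p q p∈Y q∈Y with Y⊆abr p p∈Y | Y⊆abr q q∈Y
    ... | inj₁ refl        | inj₁ refl        = visible-refl
    ... | inj₁ refl        | inj₂ (inj₁ refl) = vis-ab
    ... | inj₁ refl        | inj₂ (inj₂ refl) = vis-ar
    ... | inj₂ (inj₁ refl) | inj₁ refl        = visible-sym vis-ab
    ... | inj₂ (inj₁ refl) | inj₂ (inj₁ refl) = visible-refl
    ... | inj₂ (inj₁ refl) | inj₂ (inj₂ refl) = vis-br
    ... | inj₂ (inj₂ refl) | inj₁ refl        = visible-sym vis-ar
    ... | inj₂ (inj₂ refl) | inj₂ (inj₁ refl) = visible-sym vis-br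
    ... | inj₂ (inj₂ refl) | inj₂ (inj₂ refl) = visible-refl

  Unextendable : Fin n → Fin n → Set
  Unextendable a b = ∀ z → GeodesicAvoiding a b z → GeodesicAvoiding a z b → GeodesicAvoiding b z a → ⊥

  maximal⇒unextendable : ∀ {X} → X ⊆ ⁅ a ⁆ ∪ ⁅ b ⁆ → (∀ Y → X ⊂ Y → ¬ IsMutualVisibility G Y) →
                         Unextendable a b
  maximal⇒unextendable {X = X} X⊆ab maximal z ab az bz =
    maximal (X ∪ ⁅ z ⁆) (p⊆p∪q ⁅ z ⁆ , z , q⊆p∪q X ⁅ z ⁆ (x∈⁅x⁆ z) , z∉X)
      (triple-mutual-visibility (λ x → assocʳ ∘ map (∈⁅x⁆∪⁅y⁆⇒ ∘ X⊆ab) (x∈⁅y⁆⇒x≡y z) ∘ x∈p∪q⁻ X ⁅ z ⁆) ab az bz)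
    where
    z∉X : z ∉ X
    z∉X = [ proj₁ (avoiding⇒≢ ab) , proj₂ (avoiding⇒≢ ab) ]′ ∘ ∈⁅x⁆∪⁅y⁆⇒ ∘ X⊆ab

module EdgeDeletion {n : ℕ} (G : Graph n) (u v : Fin n) where
  open Visibility G

  private variable
    a b t : Fin n
    j k : ℕ

  DeleteEdge-sym : Symmetric (DeleteEdge G u v)
  DeleteEdge-sym (e , ¬uv) = Adj-sym e , ¬uv ∘ swap ∘ map ×-swap ×-swap

  ends≢⇒¬uv : t ≡ u ⊎ t ≡ v → a ≢ t → b ≢ t → ¬ ((a ≡ u × b ≡ v) ⊎ (a ≡ v × b ≡ u))
  ends≢⇒¬uv (inj₁ refl) a≢t _   (inj₁ (a≡u , _)) = a≢t a≡u
  ends≢⇒¬uv (inj₁ refl) _   b≢t (inj₂ (_ , b≡u)) = b≢t b≡u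
  ends≢⇒¬uv (inj₂ refl) _   b≢t (inj₁ (_ , b≡v)) = b≢t b≡v
  ends≢⇒¬uv (inj₂ refl) a≢t _   (inj₂ (a≡v , _)) = a≢t a≡v

  avoiding-walk : t ≡ u ⊎ t ≡ v → (w : Walk (Adj G) a b k) → ¬ OnWalk t w → Walk (DeleteEdge G u v) a b k
  avoiding-walk _   []      _  = []
  avoiding-walk t∈uv (e ∷ w) ¬t =
    (e , ends≢⇒¬uv t∈uv (λ { refl → ¬t here }) (λ { refl → ¬t (there (start-onWalk w)) }))
    ∷ avoiding-walk t∈uv w (¬t ∘ there)

  reroute : Walk (DeleteEdge G u v) u v j → Walk (Adj G) a b k → ∃ λ k′ → Walk (DeleteEdge G u v) a b k′
  reroute p []                  = 0 , []
  reroute p (_∷_ {a} {b} e w) with ((a ≟ᶠ u) ×-dec (b ≟ᶠ v)) ⊎-dec ((a ≟ᶠ v) ×-dec (b ≟ᶠ u))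
  ... | no ¬uv                    = ×-map suc ((e , ¬uv) ∷_) (reroute p w)
  ... | yes (inj₁ (refl , refl)) = _ , p ++ proj₂ (reroute p w)
  ... | yes (inj₂ (refl , refl)) = _ , reverse DeleteEdge-sym p ++ proj₂ (reroute p w)

  cut-edge-pair-maximal : Connected (Adj G) → IsCutEdge G u v →
                          ∀ Y → ⁅ u ⁆ ∪ ⁅ v ⁆ ⊂ Y → ¬ IsMutualVisibility G Y
  cut-edge-pair-maximal conn (e , disconnected) Y (uv⊆Y , y , y∈Y , y∉uv) mvY =
    disconnected λ a b → reroute (proj₂ u⇝v) (proj₂ (conn a b))
    where
    u∈Y : u ∈ Y
    u∈Y = uv⊆Y (x∈⁅x⁆∪⁅y⁆ u v)

    v∈Y : v ∈ Y
    v∈Y = uv⊆Y (y∈⁅x⁆∪⁅y⁆ u v)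

    u≢y : u ≢ y
    u≢y refl = y∉uv (x∈⁅x⁆∪⁅y⁆ u v)

    v≢y : v ≢ y
    v≢y refl = y∉uv (y∈⁅x⁆∪⁅y⁆ u v)

    u⇝v : ∃ λ k → Walk (DeleteEdge G u v) u v k
    u⇝v with visible⇒avoiding (mvY y u y∈Y u∈Y) v∈Y v≢y (≢-sym (Adj⇒≢ e))
           | visible⇒avoiding (mvY y v y∈Y v∈Y) u∈Y u≢y (Adj⇒≢ e)
    ... | _ , y⇝u , _ , ¬v | _ , y⇝v , _ , ¬u =
      _ , reverse DeleteEdge-sym (avoiding-walk (inj₂ refl) y⇝u ¬v) ++ avoiding-walk (inj₁ refl) y⇝v ¬u

module Distance {n : ℕ} (G : Graph n) (conn : Connected (Adj G)) where
  open Visibility G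

  private variable
    a b c p q r y z : Fin n
    k : ℕ

  shortest-walk : ∀ a b → ∃ λ k → Σ (Walk (Adj G) a b k) (IsShortest G)
  shortest-walk a b = least (λ k → Walk (Adj G) a b k) (λ k → walk? adj? k a b) (proj₁ (conn a b)) (proj₂ (conn a b))

  dist : Fin n → Fin n → ℕ
  dist a b = proj₁ (shortest-walk a b)

  geodesic : ∀ a b → Walk (Adj G) a b (dist a b)
  geodesic a b = proj₁ (proj₂ (shortest-walk a b))

  geodesic-shortest : IsShortest G (geodesic a b)
  geodesic-shortest {a} {b} = proj₂ (proj₂ (shortest-walk a b))

  dist-minimal : Walk (Adj G) a b k → dist a b ≤ k
  dist-minimal w = geodesic-shortest _ w

  dist-refl : dist a a ≡ 0
  dist-refl = n≤0⇒n≡0 (dist-minimal [])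

  dist≡0⇒≡ : dist a b ≡ 0 → a ≡ b
  dist≡0⇒≡ {a} {b} d≡0 = walk-length-0 (subst (Walk (Adj G) a b) d≡0 (geodesic a b))

  dist-sym : dist a b ≡ dist b a
  dist-sym {a} {b} = ≤-antisym (dist-minimal (reverse Adj-sym (geodesic b a))) (dist-minimal (reverse Adj-sym (geodesic a b)))

  dist-triangle : dist a c ≤ dist a b + dist b c
  dist-triangle {a} {c} {b} = dist-minimal (geodesic a b ++ geodesic b c)

  dist-edge : Adj G y z → dist y q ≤ suc (dist z q)
  dist-edge {z = z} {q} e = dist-minimal (e ∷ geodesic z q)

  Between : Fin n → Fin n → Fin n → Set
  Between p r q = dist p r + dist r q ≡ dist p q

  between? : ∀ p r q → Dec (Between p r q)
  between? p r q = dist p r + dist r q ≟ dist p q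

  between-start : Between p p q
  between-start {p} {q} = cong (_+ dist p q) dist-refl

  between-end : Between p q q
  between-end {p} {q} = trans (cong (dist p q +_) dist-refl) (+-identityʳ (dist p q))

  shortest⇒between : (w : Walk (Adj G) p q k) → IsShortest G w → OnWalk r w → Between p r q
  shortest⇒between {p} {q} {k} {r} w shortest r∈w with split-at w r∈w
  ... | i , j , w₁ , w₂ , i+j≡k = ≤-antisym upper dist-triangle
    where
    open ≤-Reasoning
    upper : dist p r + dist r q ≤ dist p q
    upper = begin
      dist p r + dist r q ≤⟨ +-mono-≤ (dist-minimal w₁) (dist-minimal w₂) ⟩
      i + j               ≡⟨ i+j≡k ⟩
      k                   ≤⟨ shortest _ (geodesic p q) ⟩
      dist p q            ∎

  geodesic-avoiding : ¬ Between p r q → GeodesicAvoiding p q r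
  geodesic-avoiding {p} {r} {q} ¬btw =
    _ , geodesic p q , geodesic-shortest , ¬btw ∘ shortest⇒between (geodesic p q) geodesic-shortest

  avoiding-step : Adj G p z → suc (dist z q) ≤ dist p q → r ≢ p → ¬ Between z r q → GeodesicAvoiding p q r
  avoiding-step {z = z} {q} e closer r≢p ¬btw =
    _ , e ∷ geodesic z q , (λ _ w → ≤-trans closer (dist-minimal w)) ,
    λ { here → r≢p refl ; (there o) → ¬btw (shortest⇒between (geodesic z q) geodesic-shortest o) }

  shortest-successor : (w : Walk (Adj G) a b k) → IsShortest G w → a ≢ b →
                       ∃ λ v → Adj G a v × suc (dist v b) ≡ k
  shortest-successor []      _        a≢b = contradiction refl a≢b
  shortest-successor (e ∷ w) shortest _   =
    _ , e , cong suc (≤-antisym (dist-minimal w) (s≤s⁻¹ (shortest _ (e ∷ geodesic _ _))))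

  module FirstEdge {a b : Fin n} (a≢b : a ≢ b) (unextendable : Unextendable a b) where

    successor : ∃ λ v → Adj G a v × suc (dist v b) ≡ dist a b
    successor = shortest-successor (geodesic a b) geodesic-shortest a≢b

    v : Fin n
    v = proj₁ successor

    a~v : Adj G a v
    a~v = proj₁ (proj₂ successor)

    v-closer : suc (dist v b) ≡ dist a b
    v-closer = proj₂ (proj₂ successor)

    dist-a-b≢0 : dist a b ≢ 0
    dist-a-b≢0 = a≢b ∘ dist≡0⇒≡

    ¬Between-v-a-b : ¬ Between v a b
    ¬Between-v-a-b btw = m+1+n≢n (dist v a) (trans (cong (dist v a +_) v-closer) btw)

    generic-case : ¬ Between z a b → ¬ Between a z b → ¬ Between z b a → ⊥
    generic-case {z} ¬Az ¬btw ¬beyond =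
      unextendable z (geodesic-avoiding ¬btw) (avoiding-sym (geodesic-avoiding ¬beyond))
                     (avoiding-sym (geodesic-avoiding ¬Az))

    module _ {y z} (y~z : Adj G y z) (Ay : Between y a b) (¬Az : ¬ Between z a b) where

      between-case : Between a z b → y ≡ a × z ≡ v
      between-case btw = y≡a , decidable-stable (z ≟ᶠ v) v-extends
        where
        z≢a : z ≢ a
        z≢a refl = ¬Az between-start

        y-close : dist y a + (dist a z + dist z b) ≤ suc (dist z b)
        y-close = subst (λ t → dist y a + t ≤ suc (dist z b)) (sym btw) (subst (_≤ _) (sym Ay) (dist-edge y~z))

        dist-y-a≡0×dist-a-z≡1 : dist y a ≡ 0 × dist a z ≡ 1
        dist-y-a≡0×dist-a-z≡1 = m+[n+o]≤1+o⇒m≡0×n≡1 _ _ _ y-close (z≢a ∘ sym ∘ dist≡0⇒≡)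

        y≡a : y ≡ a
        y≡a = dist≡0⇒≡ (proj₁ dist-y-a≡0×dist-a-z≡1)

        dist-z-b : dist z b ≡ dist v b
        dist-z-b = suc-injective (begin
          suc (dist z b)      ≡⟨ cong (_+ dist z b) (sym (proj₂ dist-y-a≡0×dist-a-z≡1)) ⟩
          dist a z + dist z b ≡⟨ btw ⟩
          dist a b            ≡⟨ sym v-closer ⟩
          suc (dist v b)      ∎)
          where open ≡-Reasoning

        v-extends : z ≢ v → ⊥
        v-extends z≢v =
          unextendable v
            (avoiding-step (subst (λ t → Adj G t z) y≡a y~z) (≤-reflexive (trans (cong suc dist-z-b) v-closer))
                           (Adj⇒≢ a~v ∘ sym) ¬Between-z-v-b)
            (avoiding-edge a~v (a≢b ∘ sym) b≢v)
            (avoiding-sym (geodesic-avoiding ¬Between-v-a-b))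
          where
          ¬Between-z-v-b : ¬ Between z v b
          ¬Between-z-v-b btw′ = z≢v (dist≡0⇒≡ (m+n≡n⇒m≡0 _ (trans btw′ dist-z-b)))

          b≢v : b ≢ v
          b≢v b≡v = z≢v (trans (dist≡0⇒≡ (trans dist-z-b (subst (λ t → dist t b ≡ 0) b≡v dist-refl))) b≡v)

      beyond-case : ¬ Between a z b → Between z b a → ⊥
      beyond-case ¬btw beyond =
        unextendable y (geodesic-avoiding ¬Between-a-y-b) (avoiding-sym (geodesic-avoiding ¬Between-y-b-a))
                       (avoiding-sym (avoiding-step y~z y-further (y≢a ∘ sym) ¬Az))
        where
        z-far : dist z b + dist a b ≤ suc (dist y a)
        z-far = subst (_≤ _) (sym (trans (cong (dist z b +_) dist-sym) beyond)) (dist-edge (Adj-sym y~z))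

        y-far : dist y a + dist a b ≤ suc (dist z b)
        y-far = subst (_≤ _) (sym Ay) (dist-edge y~z)

        dist-a-b≡1 : dist a b ≡ 1
        dist-a-b≡1 = ≤-antisym (m+o≤1+n×n+o≤1+m⇒o≤1 (dist z b) (dist y a) (dist a b) z-far y-far)
                               (n≢0⇒n>0 dist-a-b≢0)

        z-closer : dist z b ≤ dist y a
        z-closer = s≤s⁻¹ (subst (_≤ suc (dist y a)) (trans (cong (dist z b +_) dist-a-b≡1) (+-comm (dist z b) 1)) z-far)

        y-further : suc (dist z b) ≤ dist y b
        y-further = subst (suc (dist z b) ≤_) (trans (trans (+-comm 1 _) (cong (dist y a +_) (sym dist-a-b≡1))) Ay)
                          (s≤s z-closer)

        y≢a : y ≢ a
        y≢a y≡a = ¬btw (subst (λ t → Between a t b) (sym z≡b) between-end)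
          where
          z≡b : z ≡ b
          z≡b = dist≡0⇒≡ (n≤0⇒n≡0 (≤-trans z-closer (≤-reflexive (trans (cong (λ t → dist t a) y≡a) dist-refl))))

        ¬Between-a-y-b : ¬ Between a y b
        ¬Between-a-y-b btw′ = y≢a (dist≡0⇒≡ (m+n≡0⇒n≡0 (dist a y) (m+n≡n⇒m≡0 (dist a y + dist y a) (begin
          dist a y + dist y a + dist a b   ≡⟨ +-assoc (dist a y) (dist y a) (dist a b) ⟩
          dist a y + (dist y a + dist a b) ≡⟨ cong (dist a y +_) Ay ⟩
          dist a y + dist y b              ≡⟨ btw′ ⟩
          dist a b                         ∎))))
          where open ≡-Reasoning

        ¬Between-y-b-a : ¬ Between y b a
        ¬Between-y-b-a btw′ = dist-a-b≢0 (m+n≡0⇒m≡0 (dist a b) (m+n≡m⇒n≡0 (dist y a) (begin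
          dist y a + (dist a b + dist b a) ≡⟨ sym (+-assoc (dist y a) (dist a b) (dist b a)) ⟩
          dist y a + dist a b + dist b a   ≡⟨ cong (_+ dist b a) Ay ⟩
          dist y b + dist b a              ≡⟨ btw′ ⟩
          dist y a                         ∎)))
          where open ≡-Reasoning

      crossing-edge-is-av : y ≡ a × z ≡ v
      crossing-edge-is-av with between? a z b | between? z b a
      ... | yes btw | _          = between-case btw
      ... | no ¬btw | yes beyond = ⊥-elim (beyond-case ¬btw beyond)
      ... | no ¬btw | no ¬beyond = ⊥-elim (generic-case ¬Az ¬btw ¬beyond)

    first-edge-cut : IsCutEdge G a v
    first-edge-cut = a~v , λ connected → crossing-av (crossing-step (λ t → Between t a b) (λ t → between? t a b)
                                                   (proj₂ (connected a v)) between-start ¬Between-v-a-b)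
      where
      crossing-av : (∃₂ λ y z → DeleteEdge G a v y z × Between y a b × ¬ Between z a b) → ⊥
      crossing-av (y , z , (y~z , ¬av) , Ay , ¬Az) = ¬av (inj₁ (crossing-edge-is-av y~z Ay ¬Az))

module _ {m : ℕ} (G : Graph (suc (suc m))) (conn : Connected (Adj G)) where
  open Visibility G
  open Distance G conn

  neighbour : ∀ a → ∃ λ c → Adj G a c
  neighbour a = first-step (proj₂ (conn a (punchIn a zero))) (≢-sym (punchInᵢ≢i a zero))

  maximal⇒2≤∣X∣ : ∀ X → IsMaximalMV G X → 2 ≤ ∣ X ∣
  maximal⇒2≤∣X∣ X (_ , maximal) with ⊆⁅x⁆⊎∃₂≢ X
  ... | inj₂ (x , y , x∈X , y∈X , x≢y) = 2≤∣p∣ x∈X y∈X x≢y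
  ... | inj₁ (x , X⊆⁅x⁆) = contradiction (edge-mutual-visibility x~c) (maximal (⁅ x ⁆ ∪ ⁅ c ⁆) X⊂xc)
    where
    c : Fin (suc (suc m))
    c = proj₁ (neighbour x)

    x~c : Adj G x c
    x~c = proj₂ (neighbour x)

    X⊂xc : X ⊂ ⁅ x ⁆ ∪ ⁅ c ⁆
    X⊂xc = p⊆p∪q ⁅ c ⁆ ∘ X⊆⁅x⁆ , c , y∈⁅x⁆∪⁅y⁆ x c , Adj⇒≢ x~c ∘ sym ∘ x∈⁅y⁆⇒x≡y x ∘ X⊆⁅x⁆

  cut-edge⇒μ⁻≡2 : HasCutEdge G → μ⁻≡ G 2
  cut-edge⇒μ⁻≡2 (u , v , cut@(e , _)) =
    (⁅ u ⁆ ∪ ⁅ v ⁆ , (edge-mutual-visibility e , EdgeDeletion.cut-edge-pair-maximal G u v conn cut) ,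
     ∣⁅x⁆∪⁅y⁆∣≡2 u v (Adj⇒≢ e)) ,
    maximal⇒2≤∣X∣

  μ⁻≡2⇒cut-edge : μ⁻≡ G 2 → HasCutEdge G
  μ⁻≡2⇒cut-edge ((X , (_ , maximal) , ∣X∣≡2) , _) with ∣p∣≡2⇒⊆⁅x⁆∪⁅y⁆ X ∣X∣≡2
  ... | a , b , a≢b , X⊆ab = a , _ , FirstEdge.first-edge-cut a≢b (maximal⇒unextendable X⊆ab maximal)

theorem4p4 : (n : ℕ) → (G : Graph n) → 2 ≤ n → Connected (Adj G) →
    (μ⁻≡ G 2 ⇔ HasCutEdge G)
theorem4p4 (suc (suc m)) G (s≤s (s≤s z≤n)) conn = mk⇔ (μ⁻≡2⇒cut-edge G conn) (cut-edge⇒μ⁻≡2 G conn)
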